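{- Let $k\ge1$ and $n=p_1\cdots p_k$ with $p_1<\cdots<p_k$ odd primes, and $n_j=p_1\cdots p_j$. Then \[ \Psi_n(x)=H(x)\bigl(x^{n/p_1}-1\bigr),\quad\text{where}\quad H(x)=\Phi_{n_{k-1}}\!\bigl(x^{n/n_k}\bigr)\,\Phi_{n_{k-2}}\!\bigl(x^{n/n_{k-1}}\bigr)\cdots\Phi_{n_1}\!\bigl(x^{n/n_2}\bigr). \]
   Context: $\Phi_N(x)=\prod_{1\le j\le N,\gcd(j,N)=1}(x-e^{2\pi ij/N})$ and $\Psi_N(x)=\prod_{1\le j\le N,\gcd(j,N)\ne1}(x-e^{2\pi ij/N})$ are the $N$-th cyclotomic and inverse cyclotomic polynomials. For $k=1$ the product $H$ is empty and equals $1$. -}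

module Defs where

open import Level using (_⊔_)
open import Algebra.Bundles using (CommutativeRing)
open import Data.Nat using (ℕ; zero; suc; _<_; _≟_)
import Data.Nat as N
open import Data.Nat.GCD using (gcd)
open import Data.List using (List; []; _∷_; map; filter; applyUpTo; foldr; take; drop; length)
open import Data.Nat.ListAction using (product)
open import Data.Sum using (_⊎_)
open import Data.Product using (_×_)
open import Relation.Nullary using (¬_; ¬?)

-- Algebraic stand-in for the complex numbers: a commutative ring R which is an
-- integral domain and contains a primitive n-th root of unity ζ (for ℂ: ζ = e^{2πi/n}).
module _ {c ℓ} (R : CommutativeRing c ℓ) where
  open CommutativeRing R

  pow : Carrier → ℕ → Carrier
  pow x zero    = 1#
  pow x (suc m) = x * pow x m

  prodR : List Carrier → Carrier
  prodR = foldr _*_ 1#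

  IsIntegralDomain : Set (c ⊔ ℓ)
  IsIntegralDomain = (¬ (1# ≈ 0#)) × (∀ a b → a * b ≈ 0# → a ≈ 0# ⊎ b ≈ 0#)

  IsPrimitiveRoot : Carrier → ℕ → Set ℓ
  IsPrimitiveRoot ζ n = (pow ζ n ≈ 1#) × (∀ j → 0 < j → j < n → ¬ (pow ζ j ≈ 1#))

  oneTo : ℕ → List ℕ
  oneTo N = applyUpTo suc N

  -- Φ_N(y) = ∏_{1≤j≤N, gcd(j,N)=1} (y - ω^j), with ω = ζ^e  (ω = e^{2πi/N} when ζ = e^{2πi/n}, e = n/N)
  Phi : (ζ : Carrier) (e N : ℕ) → Carrier → Carrier
  Phi ζ e N y = prodR (map (λ j → y - pow ζ (j N.* e)) (filter (λ j → gcd j N ≟ 1) (oneTo N)))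

  Psi : (ζ : Carrier) (e N : ℕ) → Carrier → Carrier
  Psi ζ e N y = prodR (map (λ j → y - pow ζ (j N.* e)) (filter (λ j → ¬? (gcd j N ≟ 1)) (oneTo N)))

prefixProd : List ℕ → ℕ → ℕ
prefixProd ps j = product (take j ps)

-- n / n_j = p_{j+1} ⋯ p_k
suffixProd : List ℕ → ℕ → ℕ
suffixProd ps j = product (drop j ps)

module Submission where

open import Defs
open import Algebra.Bundles using (CommutativeRing)
open import Data.Nat using (ℕ; suc; _<_; _≤_; _∸_)
open import Data.Nat.Primality using (Prime)
open import Relation.Binary.PropositionalEquality using (_≢_)
open import Data.List using (List; length; map; applyUpTo)
open import Data.Nat.ListAction using (product)
open import Data.List.Relation.Unary.All using (All)
open import Data.List.Relation.Unary.Linked using (Linked)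
open import Data.Product using (_×_)

open import Algebra.Bundles using (CommutativeMonoid)
import Data.Nat as ℕ
import Data.Nat.Properties as ℕ
import Relation.Binary.PropositionalEquality as ≡
open import Data.Product using (proj₁)
import Data.List.Relation.Unary.All as All
import Data.List.Relation.Unary.AllPairs as AllPairs
open import Data.List.Relation.Unary.Linked.Properties using (Linked⇒AllPairs)

-- Let n = n′·p with p prime and p ∤ n′, and ω of order n.  A root ω^j of Ψ_n
-- (1 ≤ j ≤ n, gcd(j, n) ≠ 1) either is coprime to n′ and then j = l·p, so the root is (ω^p)^l
-- with gcd(l, n′) = 1, a root of Φ_{n′}; or gcd(j, n′) ≠ 1, and these j form whole residue
-- classes i + l·n′ (l < p), each contributing ∏_l (x - ω^(i + l·n′)) = x^p - (ω^p)^i.  Hence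
--   Ψ_{n′p}(x) = Φ_{n′}(x) · Ψ_{n′}(x^p)   (roots ω^p on the right).
-- Splitting off the last prime and applying the claim for p₁ ⋯ p_{k-1} to the root ζ^p and the
-- variable x^p proves the theorem by induction on k; for k = 1 the identity reads Ψ_p(x) = x - 1.

module Arithmetic where

  open import Data.Nat using (_+_; _*_; _≟_)
  open import Data.Nat.Divisibility
    using (_∣_; _∣?_; ∣-trans; ∣1⇒≡1; n∣m*n; ∣m⇒∣m*n; ∣n⇒∣m*n; ∣m∣n⇒∣m+n; ∣m+n∣m⇒∣n)
  open import Data.Nat.GCD using (gcd)
  open import Data.Nat.Coprimality as Coprime using (Coprime; coprime⇒gcd≡1; gcd≡1⇒coprime; coprime-divisor)
  open import Data.Nat.Primality using (prime⇒irreducible; ¬prime[1])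
  open import Data.List using ([]; _∷_)
  open import Data.List.Relation.Unary.All using ([]; _∷_)
  open import Data.Bool using (Bool; _∧_; not)
  open import Data.Product using (_,_)
  open import Data.Sum using (inj₁; inj₂)
  open import Function.Bundles using (_⇔_; mk⇔)
  open import Function.Construct.Composition using (_⇔-∘_)
  open import Function.Construct.Symmetry using (⇔-sym)
  open import Function.Construct.Identity using (⇔-id)
  open import Data.Product.Function.NonDependent.Propositional using (_×-⇔_)
  open import Relation.Nullary using (¬_; does; ¬?; _×-dec_; contradiction)
  open import Relation.Nullary.Decidable using (does-⇔)
  open import Relation.Binary.PropositionalEquality using (_≡_; refl; subst)

  -- Coprime a b and Coprime a c give Coprime a (b * c): a common divisor d of a and b·c is
  -- coprime to b, hence divides c.
  coprime-* : ∀ {a b c} → Coprime a b → Coprime a c → Coprime a (b * c)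
  coprime-* a⊥b a⊥c (d∣a , d∣bc) =
    a⊥c (d∣a , coprime-divisor (λ (e∣d , e∣b) → a⊥b (∣-trans e∣d d∣a , e∣b)) d∣bc)

  coprime-product : ∀ {a} {qs : List ℕ} → All (Coprime a) qs → Coprime a (product qs)
  coprime-product []           (_ , d∣1) = ∣1⇒≡1 d∣1
  coprime-product (a⊥q ∷ a⊥qs)           = coprime-* a⊥q (coprime-product a⊥qs)

  distinct-primes-coprime : ∀ {p q} → Prime p → Prime q → p ≢ q → Coprime p q
  distinct-primes-coprime {p} {q} pp pq p≢q {d} (d∣p , d∣q) with prime⇒irreducible pp d∣p
  ... | inj₁ d≡1    = d≡1
  ... | inj₂ refl with prime⇒irreducible pq d∣q
  ...   | inj₁ refl = contradiction pp ¬prime[1]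
  ...   | inj₂ p≡q  = contradiction p≡q p≢q

  ∤prime⇒coprime : ∀ {j p} → Prime p → ¬ p ∣ j → Coprime j p
  ∤prime⇒coprime pp p∤j (d∣j , d∣p) with prime⇒irreducible pp d∣p
  ... | inj₁ d≡1  = d≡1
  ... | inj₂ refl = contradiction d∣j p∤j

  coprime-*prime⇔ : ∀ {j m p} → Prime p → Coprime j (m * p) ⇔ (Coprime j m × ¬ p ∣ j)
  coprime-*prime⇔ {j} {m} {p} pp = mk⇔ split join
    where
    split : Coprime j (m * p) → Coprime j m × ¬ p ∣ j
    split j⊥mp = (λ (d∣j , d∣m) → j⊥mp (d∣j , ∣m⇒∣m*n p d∣m))
               , (λ p∣j → ¬prime[1] (subst Prime (j⊥mp (p∣j , n∣m*n m)) pp))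
    join : Coprime j m × ¬ p ∣ j → Coprime j (m * p)
    join (j⊥m , p∤j) = coprime-* j⊥m (∤prime⇒coprime pp p∤j)

  coprime-+multiple⇔ : ∀ l {m j} → Coprime (l * m + j) m ⇔ Coprime j m
  coprime-+multiple⇔ l {m} {j} = mk⇔ reduce lift
    where
    reduce : Coprime (l * m + j) m → Coprime j m
    reduce h (d∣j , d∣m) = h (∣m∣n⇒∣m+n (∣n⇒∣m*n l d∣m) d∣j , d∣m)
    lift : Coprime j m → Coprime (l * m + j) m
    lift h (d∣lmj , d∣m) = h (∣m+n∣m⇒∣n d∣lmj (∣n⇒∣m*n l d∣m) , d∣m)

  coprime-*unit⇔ : ∀ {i p m} → Coprime p m → Coprime (i * p) m ⇔ Coprime i m
  coprime-*unit⇔ {i} {p} {m} p⊥m = mk⇔ reduce lift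
    where
    reduce : Coprime (i * p) m → Coprime i m
    reduce h (d∣i , d∣m) = h (∣m⇒∣m*n p d∣i , d∣m)
    lift : Coprime i m → Coprime (i * p) m
    lift h = Coprime.sym (coprime-* (Coprime.sym h) (Coprime.sym p⊥m))

  isCoprime : ℕ → ℕ → Bool
  isCoprime j N = does (gcd j N ≟ 1)

  gcd≡1⇔coprime : ∀ {a b} → gcd a b ≡ 1 ⇔ Coprime a b
  gcd≡1⇔coprime = mk⇔ gcd≡1⇒coprime coprime⇒gcd≡1

  isCoprime-⇔ : ∀ {a b c d} → Coprime a b ⇔ Coprime c d → isCoprime a b ≡ isCoprime c d
  isCoprime-⇔ {a} {b} {c} {d} e =
    does-⇔ (⇔-sym gcd≡1⇔coprime ⇔-∘ (e ⇔-∘ gcd≡1⇔coprime)) (gcd a b ≟ 1) (gcd c d ≟ 1)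

  isCoprime-*prime : ∀ {p} → Prime p → ∀ j m → isCoprime j (m * p) ≡ isCoprime j m ∧ not (does (p ∣? j))
  isCoprime-*prime {p} pp j m =
    does-⇔ ((⇔-sym gcd≡1⇔coprime ×-⇔ ⇔-id _) ⇔-∘ (coprime-*prime⇔ pp ⇔-∘ gcd≡1⇔coprime))
           (gcd j (m * p) ≟ 1) ((gcd j m ≟ 1) ×-dec ¬? (p ∣? j))

open Arithmetic

module ListLemmas where

  open import Data.Nat using (zero; s≤s)
  open import Data.Nat.ListAction.Properties using (product-++)
  open import Data.List using ([]; _∷_; [_]; _∷ʳ_; take; drop)
  open import Data.List.Properties using (length-++; take-all; drop-all)
  open import Data.List.Relation.Unary.All using ([]; _∷_)
  open import Data.List.Relation.Unary.All.Properties using (∷ʳ⁻)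
  open import Data.List.Relation.Unary.AllPairs using (AllPairs; []; _∷_)
  open import Data.Product using (_,_)
  open import Relation.Binary.Core using (Rel)
  open import Relation.Binary.PropositionalEquality as ≡ using (_≡_; refl; cong)

  length-∷ʳ : ∀ {a} {A : Set a} (xs : List A) y → length (xs ∷ʳ y) ≡ suc (length xs)
  length-∷ʳ xs y = ≡.trans (length-++ xs) (ℕ.+-comm (length xs) 1)

  take-∷ʳ : ∀ {a} {A : Set a} j (xs : List A) y → j ≤ length xs → take j (xs ∷ʳ y) ≡ take j xs
  take-∷ʳ zero    xs       y _         = refl
  take-∷ʳ (suc j) (x ∷ xs) y (s≤s j≤n) = cong (x ∷_) (take-∷ʳ j xs y j≤n)

  drop-∷ʳ : ∀ {a} {A : Set a} j (xs : List A) y → j ≤ length xs → drop j (xs ∷ʳ y) ≡ drop j xs ∷ʳ y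
  drop-∷ʳ zero    xs       y _         = refl
  drop-∷ʳ (suc j) (x ∷ xs) y (s≤s j≤n) = drop-∷ʳ j xs y j≤n

  allPairs-∷ʳ⁻ : ∀ {a r} {A : Set a} {R : Rel A r} {xs y} →
    AllPairs R (xs ∷ʳ y) → AllPairs R xs × All (λ x → R x y) xs
  allPairs-∷ʳ⁻ {xs = []}     _          = [] , []
  allPairs-∷ʳ⁻ {xs = x ∷ xs} (Rx ∷ Rxs) with ∷ʳ⁻ Rx | allPairs-∷ʳ⁻ Rxs
  ... | Rx′ , Rxy | Rxs′ , Rxsy = (Rx′ ∷ Rxs′) , (Rxy ∷ Rxsy)

  product-∷ʳ : ∀ ps p → product (ps ∷ʳ p) ≡ product ps ℕ.* p
  product-∷ʳ ps p = ≡.trans (product-++ ps [ p ]) (cong (product ps ℕ.*_) (ℕ.*-identityʳ p))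

  prefixProd-∷ʳ : ∀ ps p j → j ≤ length ps → prefixProd (ps ∷ʳ p) j ≡ prefixProd ps j
  prefixProd-∷ʳ ps p j j≤n = cong product (take-∷ʳ j ps p j≤n)

  suffixProd-∷ʳ : ∀ ps p j → j ≤ length ps → suffixProd (ps ∷ʳ p) j ≡ suffixProd ps j ℕ.* p
  suffixProd-∷ʳ ps p j j≤n = ≡.trans (cong product (drop-∷ʳ j ps p j≤n)) (product-∷ʳ (drop j ps) p)

  prefixProd-all : ∀ ps → prefixProd ps (length ps) ≡ product ps
  prefixProd-all ps = cong product (take-all (length ps) ps ℕ.≤-refl)

  suffixProd-all : ∀ ps j → length ps ≤ j → suffixProd ps j ≡ 1
  suffixProd-all ps j n≤j = cong product (drop-all j ps n≤j)

open ListLemmas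

module RangeProduct {c ℓ} (M : CommutativeMonoid c ℓ) where

  open import Data.Nat using (zero; _+_; _*_)
  open import Data.Nat.Divisibility using (_∣_; _∣?_; ∣⇒≤; n∣m*n; ∣m+n∣m⇒∣n; ∣m∣n⇒∣m+n; ∣-refl)
  open import Data.Bool using (Bool; true; false; not; _∧_)
  open import Relation.Nullary using (Dec; yes; no; does; ¬_; contradiction)
  open import Relation.Binary.PropositionalEquality as ≡ using (_≡_)

  open CommutativeMonoid M
  open import Algebra.Properties.CommutativeSemigroup commutativeSemigroup using (interchange)
  open import Relation.Binary.Reasoning.Setoid setoid

  Π : (ℕ → Carrier) → ℕ → Carrier
  Π f zero    = ε
  Π f (suc n) = Π f n ∙ f n

  Π-cong : ∀ {f g} n → (∀ i → i < n → f i ≈ g i) → Π f n ≈ Π g n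
  Π-cong zero    f≈g = refl
  Π-cong (suc n) f≈g = ∙-cong (Π-cong n (λ i i<n → f≈g i (ℕ.m<n⇒m<1+n i<n))) (f≈g n (ℕ.n<1+n n))

  Π-ε : ∀ {f} n → (∀ i → i < n → f i ≈ ε) → Π f n ≈ ε
  Π-ε n f≈ε = trans (Π-cong n f≈ε) (Π-const n)
    where
    Π-const : ∀ n → Π (λ _ → ε) n ≈ ε
    Π-const zero    = refl
    Π-const (suc n) = trans (identityʳ _) (Π-const n)

  Π-∙ : ∀ f g n → Π (λ i → f i ∙ g i) n ≈ Π f n ∙ Π g n
  Π-∙ f g zero    = sym (identityˡ ε)
  Π-∙ f g (suc n) = trans (∙-congʳ (Π-∙ f g n)) (interchange (Π f n) (Π g n) (f n) (g n))

  Π-head : ∀ f n → Π f (suc n) ≈ f 0 ∙ Π (λ i → f (suc i)) n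
  Π-head f zero    = comm ε (f 0)
  Π-head f (suc n) = trans (∙-congʳ (Π-head f n)) (assoc _ _ _)

  Π-+ : ∀ f a b → Π f (a + b) ≈ Π f a ∙ Π (λ i → f (a + i)) b
  Π-+ f a zero    = trans (reflexive (≡.cong (Π f) (ℕ.+-identityʳ a))) (sym (identityʳ _))
  Π-+ f a (suc b) = begin
    Π f (a + suc b)                                ≡⟨ ≡.cong (Π f) (ℕ.+-suc a b) ⟩
    Π f (a + b) ∙ f (a + b)                        ≈⟨ ∙-congʳ (Π-+ f a b) ⟩
    (Π f a ∙ Π (λ i → f (a + i)) b) ∙ f (a + b)   ≈⟨ assoc _ _ _ ⟩
    Π f a ∙ (Π (λ i → f (a + i)) b ∙ f (a + b))   ∎

  Π-blocks : ∀ f b k → Π f (k * b) ≈ Π (λ l → Π (λ i → f (l * b + i)) b) k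
  Π-blocks f b zero    = refl
  Π-blocks f b (suc k) = begin
    Π f (b + k * b)                                    ≡⟨ ≡.cong (Π f) (ℕ.+-comm b (k * b)) ⟩
    Π f (k * b + b)                                    ≈⟨ Π-+ f (k * b) b ⟩
    Π f (k * b) ∙ Π (λ i → f (k * b + i)) b           ≈⟨ ∙-congʳ (Π-blocks f b k) ⟩
    Π (λ l → Π (λ i → f (l * b + i)) b) k ∙ Π (λ i → f (k * b + i)) b ∎

  Π-swap : ∀ (f : ℕ → ℕ → Carrier) b k → Π (λ l → Π (f l) b) k ≈ Π (λ i → Π (λ l → f l i) k) b
  Π-swap f b zero    = sym (Π-ε b (λ _ _ → refl))
  Π-swap f b (suc k) = trans (∙-congʳ (Π-swap f b k)) (sym (Π-∙ (λ i → Π (λ l → f l i) k) (f k) b))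

  Π-residues : ∀ f m k → Π f (k * m) ≈ Π (λ i → Π (λ l → f (l * m + i)) k) m
  Π-residues f m k = trans (Π-blocks f m k) (Π-swap (λ l i → f (l * m + i)) m k)

  select : Bool → Carrier → Carrier
  select true  a = a
  select false a = ε

  select-cong : ∀ b {u v} → u ≈ v → select b u ≈ select b v
  select-cong true  u≈v = u≈v
  select-cong false u≈v = refl

  select-≡ : ∀ {b b′ u v} → b ≡ b′ → u ≈ v → select b u ≈ select b′ v
  select-≡ {b} ≡.refl = select-cong b

  select-yes : ∀ {a} {A : Set a} (A? : Dec A) → A → ∀ u → select (does A?) u ≈ u
  select-yes (yes _) _ u = refl
  select-yes (no ¬a) a u = contradiction a ¬a

  select-no : ∀ {a} {A : Set a} (A? : Dec A) → ¬ A → ∀ u → select (does A?) u ≈ ε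
  select-no (yes a) ¬a u = contradiction a ¬a
  select-no (no _)  _  u = refl

  select-Π : ∀ b f n → select b (Π f n) ≈ Π (λ l → select b (f l)) n
  select-Π true  f n = refl
  select-Π false f n = sym (Π-ε n (λ _ _ → refl))

  select-split : ∀ a d u → select (not (a ∧ not d)) u ≈ select d (select a u) ∙ select (not a) u
  select-split true  true  u = sym (identityʳ u)
  select-split true  false u = sym (identityˡ ε)
  select-split false true  u = sym (identityˡ u)
  select-split false false u = sym (identityˡ u)

  Π-multiples : ∀ q k (h : ℕ → Carrier) →
    Π (λ i → select (does (suc q ∣? suc i)) (h (suc i))) (k * suc q) ≈ Π (λ l → h (suc l * suc q)) k
  Π-multiples q k h = trans (Π-blocks _ p k) (Π-cong k (λ l _ → block l))
    where
    p = suc q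
    -- in the block l·p < j ≤ (l+1)·p only the last index j = (l+1)·p is a multiple of p
    block : ∀ l → Π (λ r → select (does (p ∣? suc (l * p + r))) (h (suc (l * p + r)))) p ≈ h (suc l * p)
    block l = trans (∙-cong (Π-ε q (λ r r<q → select-no (p ∣? _) (p∤ r r<q) _)) last) (identityˡ _)
      where
      p∤ : ∀ r → r < q → ¬ p ∣ suc (l * p + r)
      p∤ r r<q p∣ = ℕ.<-irrefl ≡.refl (ℕ.≤-trans (∣⇒≤ p∣1+r) r<q)
        where
        p∣1+r : p ∣ suc r
        p∣1+r = ∣m+n∣m⇒∣n (≡.subst (p ∣_) (≡.sym (ℕ.+-suc (l * p) r)) p∣) (n∣m*n l)
      top : suc (l * p + q) ≡ suc l * p
      top = ≡.trans (≡.sym (ℕ.+-suc (l * p) q)) (ℕ.+-comm (l * p) p)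
      last : select (does (p ∣? suc (l * p + q))) (h (suc (l * p + q))) ≈ h (suc l * p)
      last = trans (select-yes (p ∣? _) (≡.subst (p ∣_) (≡.sym top) (∣m∣n⇒∣m+n ∣-refl (n∣m*n l))) _)
                   (reflexive (≡.cong h top))

module Polynomials {c ℓ} (R : CommutativeRing c ℓ) where

  open import Level using (_⊔_)
  open import Data.Nat using (zero)
  open import Data.Product using (Σ; _,_)
  open import Data.Sum using (inj₁; inj₂)
  import Relation.Binary.PropositionalEquality as ≡

  open CommutativeRing R
  open import Relation.Binary.Reasoning.Setoid setoid
  open import Algebra.Solver.Ring.NaturalCoefficients.Default commutativeSemiring
  open import Algebra.Properties.AbelianGroup +-abelianGroup using (xyx⁻¹≈y)
  open import Algebra.Properties.Semiring.Exp semiring using (_^_; ^-homo-*; ^-assocʳ; ^-congˡ)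
  open RangeProduct *-commutativeMonoid

  pow≈^ : ∀ x n → pow R x n ≈ x ^ n
  pow≈^ x zero    = refl
  pow≈^ x (suc n) = *-congˡ (pow≈^ x n)

  pow-+ : ∀ x a b → pow R x (a ℕ.+ b) ≈ pow R x a * pow R x b
  pow-+ x a b = trans (pow≈^ x (a ℕ.+ b)) (trans (^-homo-* x a b) (sym (*-cong (pow≈^ x a) (pow≈^ x b))))

  pow-* : ∀ x a b → pow R (pow R x a) b ≈ pow R x (a ℕ.* b)
  pow-* x a b = trans (pow≈^ (pow R x a) b)
    (trans (^-congˡ b (pow≈^ x a)) (trans (^-assocʳ x a b) (sym (pow≈^ x (a ℕ.* b)))))

  pow-congˡ : ∀ {x y} n → x ≈ y → pow R x n ≈ pow R y n
  pow-congˡ zero    x≈y = refl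
  pow-congˡ (suc n) x≈y = *-cong x≈y (pow-congˡ n x≈y)

  pow-1# : ∀ n → pow R 1# n ≈ 1#
  pow-1# zero    = refl
  pow-1# (suc n) = trans (*-identityˡ _) (pow-1# n)

  Π-zero : ∀ f n i → i < n → f i ≈ 0# → Π f n ≈ 0#
  Π-zero f (suc n) i i<1+n fi≈0 with ℕ.m<1+n⇒m<n∨m≡n i<1+n
  ... | inj₁ i<n    = trans (*-congʳ (Π-zero f n i i<n fi≈0)) (zeroˡ (f n))
  ... | inj₂ ≡.refl = trans (*-congˡ fi≈0) (zeroʳ (Π f n))

  -- Writing x as a + (x - a) turns identities about x - a into semiring identities.
  x≈a+[x-a] : ∀ a x → x ≈ a + (x - a)
  x≈a+[x-a] a x = sym (trans (sym (+-assoc a x (- a))) (xyx⁻¹≈y a x))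

  -- Poly d f : f agrees with a polynomial function of degree < d, given in Horner form.
  Poly : ℕ → (Carrier → Carrier) → Set (c ⊔ ℓ)
  Poly zero    f = ∀ x → f x ≈ 0#
  Poly (suc d) f = Σ Carrier λ a → Σ (Carrier → Carrier) λ g → Poly d g × (∀ x → f x ≈ a + x * g x)

  Poly-ext : ∀ d {f g} → (∀ x → f x ≈ g x) → Poly d f → Poly d g
  Poly-ext zero    f≈g f0                = λ x → trans (sym (f≈g x)) (f0 x)
  Poly-ext (suc d) f≈g (a , g , gp , hf) = a , g , gp , λ x → trans (sym (f≈g x)) (hf x)

  Poly-zero : ∀ d → Poly d (λ _ → 0#)
  Poly-zero zero    = λ _ → refl
  Poly-zero (suc d) = 0# , (λ _ → 0#) , Poly-zero d , λ x → sym (trans (+-identityˡ _) (zeroʳ x))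

  Poly-const : ∀ d a → Poly (suc d) (λ _ → a)
  Poly-const d a = a , (λ _ → 0#) , Poly-zero d , λ x → sym (trans (+-congˡ (zeroʳ x)) (+-identityʳ a))

  Poly-+ : ∀ d {f g} → Poly d f → Poly d g → Poly d (λ x → f x + g x)
  Poly-+ zero    f0 g0 = λ x → trans (+-cong (f0 x) (g0 x)) (+-identityˡ 0#)
  Poly-+ (suc d) (a , f' , fp , hf) (b , g' , gp , hg) =
    a + b , (λ x → f' x + g' x) , Poly-+ d fp gp , λ x → trans (+-cong (hf x) (hg x))
      (solve 5 (λ a b x u v → (a :+ x :* u) :+ (b :+ x :* v) := (a :+ b) :+ x :* (u :+ v)) refl a b x (f' x) (g' x))

  Poly-scale : ∀ d k {f} → Poly d f → Poly d (λ x → k * f x)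
  Poly-scale zero    k f0 = λ x → trans (*-congˡ (f0 x)) (zeroʳ k)
  Poly-scale (suc d) k (a , g , gp , hf) = k * a , (λ x → k * g x) , Poly-scale d k gp , λ x → trans (*-congˡ (hf x))
    (solve 4 (λ k a x u → k :* (a :+ x :* u) := k :* a :+ x :* (k :* u)) refl k a x (g x))

  Poly-x* : ∀ d {g} → Poly d g → Poly (suc d) (λ x → x * g x)
  Poly-x* d gp = 0# , _ , gp , λ x → sym (+-identityˡ _)

  Poly-mono : ∀ d {f} → Poly d f → Poly (suc d) f
  Poly-mono zero    f0                = Poly-ext 1 (λ x → sym (f0 x)) (Poly-const 0 0#)
  Poly-mono (suc d) (a , g , gp , hf) = a , g , Poly-mono d gp , hf

  Poly-pow : ∀ d → Poly (suc d) (λ x → pow R x d)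
  Poly-pow zero    = Poly-const 0 1#
  Poly-pow (suc d) = Poly-x* (suc d) (Poly-pow d)

  divide : ∀ d {f} → Poly (suc d) f → ∀ a →
    Σ (Carrier → Carrier) λ q → Poly d q × (∀ x → f x ≈ f a + (x - a) * q x)
  divide zero {f} (b , g , g0 , hf) a =
    (λ _ → 0#) , (λ _ → refl) , λ x → trans (f≈b x) (sym (trans (+-cong (f≈b a) (zeroʳ _)) (+-identityʳ b)))
    where
    f≈b : ∀ x → f x ≈ b
    f≈b x = trans (hf x) (trans (+-congˡ (trans (*-congˡ (g0 x)) (zeroʳ x))) (+-identityʳ b))
  divide (suc d) {f} (b , g , gp , hf) a with divide d gp a
  ... | q , qp , hg = (λ x → g a + x * q x) , (g a , q , qp , λ _ → refl) , eq
    where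
    eq : ∀ x → f x ≈ f a + (x - a) * (g a + x * q x)
    eq x = begin
      f x                                   ≈⟨ hf x ⟩
      b + x * g x                           ≈⟨ +-congˡ (*-cong (x≈a+[x-a] a x) (hg x)) ⟩
      b + (a + t) * (g a + t * q x)
        ≈⟨ solve 5 (λ b a t G Q → b :+ (a :+ t) :* (G :+ t :* Q) := (b :+ a :* G) :+ t :* (G :+ (a :+ t) :* Q))
                   refl b a t (g a) (q x) ⟩
      (b + a * g a) + t * (g a + (a + t) * q x)
        ≈⟨ +-cong (sym (hf a)) (*-congˡ (+-congˡ (*-congʳ (sym (x≈a+[x-a] a x))))) ⟩
      f a + t * (g a + x * q x)             ∎
      where t = x - a

module IntegralDomain {c ℓ} (R : CommutativeRing c ℓ) (isID : IsIntegralDomain R) where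

  open import Data.Nat using (zero)
  open import Data.Product using (Σ; _,_; proj₂)
  open import Data.Sum using (inj₁; inj₂)
  open import Relation.Nullary using (¬_; contradiction)
  open import Relation.Binary.PropositionalEquality as ≡ using (_≡_)
  import Data.Nat.Tactic.RingSolver as ℕ-Solver

  open CommutativeRing R
  open import Relation.Binary.Reasoning.Setoid setoid
  open import Algebra.Solver.Ring.NaturalCoefficients.Default commutativeSemiring
  open import Algebra.Properties.Ring ring using (x[y-z]≈xy-xz)
  open import Algebra.Properties.Group +-group using (inverseˡ-unique; x∙y⁻¹≈ε⇒x≈y; x≈y⇒x∙y⁻¹≈ε)
  open RangeProduct *-commutativeMonoid
  open Polynomials R

  cancelˡ : ∀ {a b} → ¬ a ≈ 0# → a * b ≈ 0# → b ≈ 0#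
  cancelˡ {a} {b} a≉0 ab≈0 with proj₂ isID a b ab≈0
  ... | inj₁ a≈0 = contradiction a≈0 a≉0
  ... | inj₂ b≈0 = b≈0

  pow-nonzero : ∀ {x} → ¬ x ≈ 0# → ∀ n → ¬ pow R x n ≈ 0#
  pow-nonzero x≉0 zero    = proj₁ isID
  pow-nonzero x≉0 (suc n) xxⁿ≈0 = pow-nonzero x≉0 n (cancelˡ x≉0 xxⁿ≈0)

  Distinct : ℕ → (ℕ → Carrier) → Set ℓ
  Distinct d r = ∀ i j → i < j → j < d → ¬ r i ≈ r j

  vanish : ∀ d {f} (r : ℕ → Carrier) → Poly d f → Distinct d r → (∀ i → i < d → f (r i) ≈ 0#) →
    ∀ x → f x ≈ 0#
  vanish zero    r f0 _ _ = f0
  vanish (suc d) {f} r fp distinct roots x with divide d fp (r d)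
  ... | q , qp , hq = trans (hq x) (trans (+-cong f[rd]≈0 (trans (*-congˡ (q≈0 x)) (zeroʳ _))) (+-identityˡ 0#))
    where
    f[rd]≈0 : f (r d) ≈ 0#
    f[rd]≈0 = roots d (ℕ.n<1+n d)
    -- q (r i) is cancelled by the nonzero factor r i - r d
    q-roots : ∀ i → i < d → q (r i) ≈ 0#
    q-roots i i<d = cancelˡ (λ e → distinct i d i<d (ℕ.n<1+n d) (x∙y⁻¹≈ε⇒x≈y _ _ e))
      (trans (sym (trans (hq (r i)) (trans (+-congʳ f[rd]≈0) (+-identityˡ _)))) (roots i (ℕ.m<n⇒m<1+n i<d)))
    q≈0 : ∀ x → q x ≈ 0#
    q≈0 = vanish d r qp (λ i j i<j j<d → distinct i j i<j (ℕ.m<n⇒m<1+n j<d)) q-roots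

  Π-linear-monic : ∀ (r : ℕ → Carrier) d →
    Σ (Carrier → Carrier) λ D → Poly d D × (∀ x → Π (λ l → x - r l) d ≈ pow R x d + D x)
  Π-linear-monic r zero    = (λ _ → 0#) , (λ _ → refl) , λ _ → sym (+-identityʳ 1#)
  Π-linear-monic r (suc d) with Π-linear-monic r d
  ... | D , Dp , hD = D′ , D′p , eq
    where
    D′ : Carrier → Carrier
    D′ x = x * D x + - r d * (pow R x d + D x)
    D′p : Poly (suc d) D′
    D′p = Poly-+ (suc d) (Poly-x* d Dp) (Poly-scale (suc d) (- r d) (Poly-+ (suc d) (Poly-pow d) (Poly-mono d Dp)))
    eq : ∀ x → Π (λ l → x - r l) d * (x - r d) ≈ x * pow R x d + D′ x
    eq x = trans (*-congʳ (hD x)) (solve 4 (λ X D x n → (X :+ D) :* (x :+ n) := x :* X :+ (x :* D :+ n :* (X :+ D)))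
                                           refl (pow R x d) (D x) x (- r d))

  pow-factor : ∀ d (r : ℕ → Carrier) c → Distinct (suc d) r →
    (∀ i → i < suc d → pow R (r i) (suc d) ≈ c) →
    ∀ x → pow R x (suc d) - c ≈ Π (λ l → x - r l) (suc d)
  pow-factor d r c distinct roots x with Π-linear-monic r (suc d)
  ... | D , Dp , hD = trans (+-congˡ (sym (D≈-c x))) (sym (hD x))
    where
    D+c-roots : ∀ i → i < suc d → D (r i) + c ≈ 0#
    D+c-roots i i<1+d = begin
      D (r i) + c                    ≈⟨ +-comm _ c ⟩
      c + D (r i)                    ≈⟨ +-congʳ (roots i i<1+d) ⟨
      pow R (r i) (suc d) + D (r i)  ≈⟨ hD (r i) ⟨
      Π (λ l → r i - r l) (suc d)    ≈⟨ Π-zero _ (suc d) i i<1+d (x≈y⇒x∙y⁻¹≈ε refl) ⟩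
      0#                             ∎
    D≈-c : ∀ x → D x ≈ - c
    D≈-c x = inverseˡ-unique _ _ (vanish (suc d) r (Poly-+ (suc d) Dp (Poly-const d c)) distinct D+c-roots x)

  Primitive : Carrier → ℕ → Set ℓ
  Primitive = IsPrimitiveRoot R

  primitive-nonzero : ∀ {ω} n → 0 < n → Primitive ω n → ¬ ω ≈ 0#
  primitive-nonzero {ω} (suc n) _ (ωⁿ≈1 , _) ω≈0 =
    proj₁ isID (trans (sym ωⁿ≈1) (trans (*-congʳ ω≈0) (zeroˡ _)))

  primitive-period : ∀ {ω} n → Primitive ω n → ∀ a l → pow R ω (a ℕ.+ l ℕ.* n) ≈ pow R ω a
  primitive-period {ω} n (ωⁿ≈1 , _) a l = begin
    pow R ω (a ℕ.+ l ℕ.* n)          ≈⟨ pow-+ ω a (l ℕ.* n) ⟩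
    pow R ω a * pow R ω (l ℕ.* n)    ≡⟨ ≡.cong (λ e → pow R ω a * pow R ω e) (ℕ.*-comm l n) ⟩
    pow R ω a * pow R ω (n ℕ.* l)    ≈⟨ *-congˡ (pow-* ω n l) ⟨
    pow R ω a * pow R (pow R ω n) l  ≈⟨ *-congˡ (trans (pow-congˡ l ωⁿ≈1) (pow-1# l)) ⟩
    pow R ω a * 1#                   ≈⟨ *-identityʳ _ ⟩
    pow R ω a                        ∎

  primitive-distinct : ∀ {ω} n → Primitive ω n → ∀ a t → 0 < t → t < n →
    ¬ pow R ω a ≈ pow R ω (a ℕ.+ t)
  primitive-distinct {ω} n prim a t 0<t t<n ωᵃ≈ωᵃ⁺ᵗ =
    proj₂ prim t 0<t t<n (x∙y⁻¹≈ε⇒x≈y _ _ ωᵗ-1≈0)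
    where
    ωᵃ[ωᵗ-1]≈0 : pow R ω a * (pow R ω t - 1#) ≈ 0#
    ωᵃ[ωᵗ-1]≈0 = trans (x[y-z]≈xy-xz _ _ _)
      (x≈y⇒x∙y⁻¹≈ε (trans (sym (pow-+ ω a t)) (trans (sym ωᵃ≈ωᵃ⁺ᵗ) (sym (*-identityʳ _)))))
    ωᵗ-1≈0 : pow R ω t - 1# ≈ 0#
    ωᵗ-1≈0 = cancelˡ (pow-nonzero (primitive-nonzero n (ℕ.<-trans 0<t t<n) prim) a) ωᵃ[ωᵗ-1]≈0

  primitive-pow : ∀ {ω} m p → 0 < p → Primitive ω (m ℕ.* p) → Primitive (pow R ω p) m
  primitive-pow {ω} m p 0<p (ωᵐᵖ≈1 , minimal) =
    trans (pow-* ω p m) (trans (reflexive (≡.cong (pow R ω) (ℕ.*-comm p m))) ωᵐᵖ≈1) ,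
    λ j 0<j j<m ωᵖʲ≈1 → minimal (j ℕ.* p) (ℕ.*-mono-< 0<j 0<p) (ℕ.*-monoˡ-< p {{ℕ.>-nonZero 0<p}} j<m)
      (trans (reflexive (≡.cong (pow R ω) (ℕ.*-comm j p))) (trans (sym (pow-* ω p j)) ωᵖʲ≈1))

  coset-factor : ∀ {ω} m q → 0 < m → Primitive ω (m ℕ.* suc q) → ∀ s x →
    pow R x (suc q) - pow R ω (s ℕ.* suc q) ≈ Π (λ l → x - pow R ω (s ℕ.+ l ℕ.* m)) (suc q)
  coset-factor {ω} m q 0<m prim s = pow-factor q (λ l → pow R ω (s ℕ.+ l ℕ.* m)) _ distinct roots
    where
    p = suc q
    distinct : Distinct p (λ l → pow R ω (s ℕ.+ l ℕ.* m))
    distinct a b a<b b<p e = primitive-distinct (m ℕ.* p) prim (s ℕ.+ a ℕ.* m) ((b ℕ.∸ a) ℕ.* m) 0<t t<mp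
      (trans e (reflexive (≡.cong (pow R ω) shift)))
      where
      0<t : 0 < (b ℕ.∸ a) ℕ.* m
      0<t = ℕ.*-mono-< (ℕ.m<n⇒0<n∸m a<b) 0<m
      t<mp : (b ℕ.∸ a) ℕ.* m < m ℕ.* p
      t<mp = ℕ.≤-<-trans (ℕ.*-monoˡ-≤ m (ℕ.m∸n≤m b a))
        (≡.subst (b ℕ.* m <_) (ℕ.*-comm p m) (ℕ.*-monoˡ-< m {{ℕ.>-nonZero 0<m}} b<p))
      shift : s ℕ.+ b ℕ.* m ≡ (s ℕ.+ a ℕ.* m) ℕ.+ (b ℕ.∸ a) ℕ.* m
      shift = ≡.trans (≡.cong (λ b → s ℕ.+ b ℕ.* m) (≡.sym (ℕ.m+[n∸m]≡n (ℕ.<⇒≤ a<b))))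
                      (+-*-shift s a (b ℕ.∸ a) m)
        where
        +-*-shift : ∀ s a d m → s ℕ.+ (a ℕ.+ d) ℕ.* m ≡ (s ℕ.+ a ℕ.* m) ℕ.+ d ℕ.* m
        +-*-shift = ℕ-Solver.solve-∀
    roots : ∀ l → l < p → pow R (pow R ω (s ℕ.+ l ℕ.* m)) p ≈ pow R ω (s ℕ.* p)
    roots l _ = trans (pow-* ω (s ℕ.+ l ℕ.* m) p)
      (trans (reflexive (≡.cong (pow R ω) (exponent s l m p))) (primitive-period (m ℕ.* p) prim (s ℕ.* p) l))
      where
      exponent : ∀ s l m p → (s ℕ.+ l ℕ.* m) ℕ.* p ≡ s ℕ.* p ℕ.+ l ℕ.* (m ℕ.* p)
      exponent = ℕ-Solver.solve-∀

module Cyclotomic {c ℓ} (R : CommutativeRing c ℓ) (isID : IsIntegralDomain R) where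

  open import Level using (_⊔_)
  open import Data.Nat using (zero; z≤n; s≤s; z<s; _≟_)
  import Data.Nat.Tactic.RingSolver as ℕ-Solver
  open import Data.Nat.Divisibility using (_∣?_)
  open import Data.Nat.GCD using (gcd)
  open import Data.Nat.Coprimality using (Coprime)
  open import Data.Nat.Primality using (¬prime[0]; prime⇒nonZero; productOfPrimes≥1)
  open import Data.List using ([]; _∷_; [_]; _∷ʳ_; filter; initLast; _∷ʳ′_)
  open import Data.List.Relation.Unary.All using ([]; _∷_)
  open import Data.List.Relation.Unary.All.Properties using (∷ʳ⁻)
  open import Data.List.Relation.Unary.AllPairs using (AllPairs)
  open import Data.Bool using (true; false; not)
  open import Data.Product using (_,_; proj₂)
  open import Relation.Nullary using (¬?; does; contradiction)
  open import Relation.Unary using (Decidable)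
  open import Relation.Binary.PropositionalEquality as ≡ using (_≡_; ≢-sym)

  open CommutativeRing R
  open import Relation.Binary.Reasoning.Setoid setoid
  open import Algebra.Properties.CommutativeSemigroup *-commutativeSemigroup using (x∙yz≈yx∙z)
  open RangeProduct *-commutativeMonoid
  open Polynomials R
  open IntegralDomain R isID

  prodR-applyUpTo : ∀ (f : ℕ → Carrier) g n → prodR R (map f (applyUpTo g n)) ≈ Π (λ i → f (g i)) n
  prodR-applyUpTo f g zero    = refl
  prodR-applyUpTo f g (suc n) = trans (*-congˡ (prodR-applyUpTo f (λ i → g (suc i)) n)) (sym (Π-head _ n))

  prodR-filter : ∀ {p} {P : ℕ → Set p} (P? : Decidable P) (f : ℕ → Carrier) L →
    prodR R (map f (filter P? L)) ≈ prodR R (map (λ j → select (does (P? j)) (f j)) L)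
  prodR-filter P? f []      = refl
  prodR-filter P? f (j ∷ L) with does (P? j)
  ... | true  = *-congˡ (prodR-filter P? f L)
  ... | false = trans (prodR-filter P? f L) (sym (*-identityˡ _))

  -- rootProduct P? ω e N y = ∏_{1≤j≤N, P j} (y - ω^(j·e)).  With P j = "gcd j N ≡ 1" this is Phi,
  -- with its negation Psi: the N-th (inverse) cyclotomic polynomial at the root ω^e.
  rootProduct : ∀ {p} {P : ℕ → Set p} → Decidable P → Carrier → ℕ → ℕ → Carrier → Carrier
  rootProduct P? ω e N y = prodR R (map (λ j → y - pow R ω (j ℕ.* e)) (filter P? (oneTo R N)))

  rootProduct-Π : ∀ {p} {P : ℕ → Set p} (P? : Decidable P) ω e N y →
    rootProduct P? ω e N y ≈ Π (λ i → select (does (P? (suc i))) (y - pow R ω (suc i ℕ.* e))) N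
  rootProduct-Π P? ω e N y = trans (prodR-filter P? _ (oneTo R N)) (prodR-applyUpTo _ suc N)

  rootProduct-congʳ : ∀ {p} {P : ℕ → Set p} (P? : Decidable P) ω e N {y y′} → y ≈ y′ →
    rootProduct P? ω e N y ≈ rootProduct P? ω e N y′
  rootProduct-congʳ P? ω e N y≈y′ = trans (rootProduct-Π P? ω e N _)
    (trans (Π-cong N (λ i _ → select-cong (does (P? (suc i))) (+-congʳ y≈y′))) (sym (rootProduct-Π P? ω e N _)))

  rootProduct-rescale : ∀ {p} {P : ℕ → Set p} (P? : Decidable P) ζ a e N y →
    rootProduct P? (pow R ζ a) e N y ≈ rootProduct P? ζ (e ℕ.* a) N y
  rootProduct-rescale P? ζ a e N y = trans (rootProduct-Π P? (pow R ζ a) e N y)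
    (trans (Π-cong N (λ i _ → select-cong (does (P? (suc i))) (+-congˡ (-‿cong (exponent (suc i))))))
           (sym (rootProduct-Π P? ζ (e ℕ.* a) N y)))
    where
    exponent : ∀ j → pow R (pow R ζ a) (j ℕ.* e) ≈ pow R ζ (j ℕ.* (e ℕ.* a))
    exponent j = trans (pow-* ζ a (j ℕ.* e)) (reflexive (≡.cong (pow R ζ) (reorder a j e)))
      where
      reorder : ∀ a j e → a ℕ.* (j ℕ.* e) ≡ j ℕ.* (e ℕ.* a)
      reorder = ℕ-Solver.solve-∀

  Phi-congʳ : ∀ ζ e N {y y′} → y ≈ y′ → Phi R ζ e N y ≈ Phi R ζ e N y′
  Phi-congʳ ζ e N = rootProduct-congʳ (λ j → gcd j N ≟ 1) ζ e N

  Phi-rescale : ∀ ζ a e N y → Phi R (pow R ζ a) e N y ≈ Phi R ζ (e ℕ.* a) N y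
  Phi-rescale ζ a e N = rootProduct-rescale (λ j → gcd j N ≟ 1) ζ a e N

  Psi-rescale : ∀ ζ a N y → Psi R ζ a N y ≈ Psi R (pow R ζ a) 1 N y
  Psi-rescale ζ a N y = trans (reflexive (≡.cong (λ e → Psi R ζ e N y) (≡.sym (ℕ.*-identityˡ a))))
                              (sym (rootProduct-rescale (λ j → ¬? (gcd j N ≟ 1)) ζ a 1 N y))

  -- The roots ω^j (1 ≤ j ≤ m·p) that are multiples of p and coprime to m are the roots
  -- (ω^p)^l of Φ_m, l coprime to m (using that p is a unit modulo m).
  Phi-part : ∀ {ω} m q → Coprime (suc q) m → ∀ x →
    Π (λ i → select (does (suc q ∣? suc i)) (select (isCoprime (suc i) m) (x - pow R ω (suc i ℕ.* 1))))
      (m ℕ.* suc q)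
    ≈ Π (λ l → select (isCoprime (suc l) m) (x - pow R ω (suc l ℕ.* suc q))) m
  Phi-part {ω} m q p⊥m x = trans (Π-multiples q m h) (Π-cong m (λ l _ →
    select-≡ (isCoprime-⇔ (coprime-*unit⇔ {suc l} p⊥m))
             (+-congˡ (-‿cong (reflexive (≡.cong (pow R ω) (ℕ.*-identityʳ (suc l ℕ.* suc q))))))))
    where
    h : ℕ → Carrier
    h j = select (isCoprime j m) (x - pow R ω (j ℕ.* 1))

  -- The roots ω^j (1 ≤ j ≤ m·p) not coprime to m fall into the residue classes j ≡ i (mod m)
  -- with gcd(i, m) ≠ 1; the class of i contributes ∏_l (x - ω^(i + l·m)) = x^p - ω^(i·p), and
  -- these are the factors of Ψ_m(x^p) at the root ω^p.
  Psi-part : ∀ {ω} m q → 0 < m → Primitive ω (m ℕ.* suc q) → ∀ x →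
    Π (λ i → select (not (isCoprime (suc i) m)) (x - pow R ω (suc i ℕ.* 1))) (m ℕ.* suc q)
    ≈ Π (λ i → select (not (isCoprime (suc i) m)) (pow R x (suc q) - pow R ω (suc i ℕ.* suc q))) m
  Psi-part {ω} m q 0<m prim x = begin
    Π B (m ℕ.* p)                                  ≡⟨ ≡.cong (Π B) (ℕ.*-comm m p) ⟩
    Π B (p ℕ.* m)                                  ≈⟨ Π-residues B m p ⟩
    Π (λ i → Π (λ l → B (l ℕ.* m ℕ.+ i)) p) m      ≈⟨ Π-cong m (λ i _ → residue-class i) ⟩
    Π (λ i → select (not (isCoprime (suc i) m)) (pow R x p - pow R ω (suc i ℕ.* p))) m ∎
    where
    p = suc q
    B : ℕ → Carrier
    B i = select (not (isCoprime (suc i) m)) (x - pow R ω (suc i ℕ.* 1))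
    residue-class : ∀ i → Π (λ l → B (l ℕ.* m ℕ.+ i)) p ≈
                          select (not (isCoprime (suc i) m)) (pow R x p - pow R ω (suc i ℕ.* p))
    residue-class i = begin
      Π (λ l → B (l ℕ.* m ℕ.+ i)) p
        ≈⟨ Π-cong p (λ l _ → select-≡ (same-class l) (same-root l)) ⟩
      Π (λ l → select b (x - pow R ω (suc i ℕ.+ l ℕ.* m))) p
        ≈⟨ select-Π b _ p ⟨
      select b (Π (λ l → x - pow R ω (suc i ℕ.+ l ℕ.* m)) p)
        ≈⟨ select-cong b (coset-factor m q 0<m prim (suc i) x) ⟨
      select b (pow R x p - pow R ω (suc i ℕ.* p))            ∎
      where
      b = not (isCoprime (suc i) m)
      same-class : ∀ l → not (isCoprime (suc (l ℕ.* m ℕ.+ i)) m) ≡ b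
      same-class l = ≡.cong not (≡.trans (≡.cong (λ j → isCoprime j m) (≡.sym (ℕ.+-suc (l ℕ.* m) i)))
                                         (isCoprime-⇔ (coprime-+multiple⇔ l)))
      same-root : ∀ l → x - pow R ω (suc (l ℕ.* m ℕ.+ i) ℕ.* 1) ≈ x - pow R ω (suc i ℕ.+ l ℕ.* m)
      same-root l = +-congˡ (-‿cong (reflexive (≡.cong (pow R ω) (exponent i l m))))
        where
        exponent : ∀ i l m → suc (l ℕ.* m ℕ.+ i) ℕ.* 1 ≡ suc i ℕ.+ l ℕ.* m
        exponent = ℕ-Solver.solve-∀

  -- A root ω^j of Ψ_{mp} either has gcd(j, m) = 1 and p ∣ j (Phi-part) or gcd(j, m) ≠ 1 (Psi-part).
  Psi-*prime : ∀ {ω} m p → Prime p → Coprime p m → 0 < m → Primitive ω (m ℕ.* p) → ∀ x →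
    Psi R ω 1 (m ℕ.* p) x ≈ Phi R ω p m x * Psi R ω p m (pow R x p)
  Psi-*prime m zero    pp _   _   _    _ = contradiction pp ¬prime[0]
  Psi-*prime {ω} m p@(suc q) pp p⊥m 0<m prim x = begin
    Psi R ω 1 n x
      ≈⟨ rootProduct-Π (λ j → ¬? (gcd j n ≟ 1)) ω 1 n x ⟩
    Π (λ i → select (not (isCoprime (suc i) n)) (g (suc i))) n
      ≈⟨ Π-cong n (λ i _ → split (suc i)) ⟩
    Π (λ i → A i * B i) n
      ≈⟨ Π-∙ A B n ⟩
    Π A n * Π B n
      ≈⟨ *-cong (Phi-part m q p⊥m x) (Psi-part m q 0<m prim x) ⟩
    Π (λ i → select (isCoprime (suc i) m) (x - pow R ω (suc i ℕ.* p))) m *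
    Π (λ i → select (not (isCoprime (suc i) m)) (pow R x p - pow R ω (suc i ℕ.* p))) m
      ≈⟨ *-cong (rootProduct-Π (λ j → gcd j m ≟ 1) ω p m x)
                (rootProduct-Π (λ j → ¬? (gcd j m ≟ 1)) ω p m (pow R x p)) ⟨
    Phi R ω p m x * Psi R ω p m (pow R x p)                  ∎
    where
    n = m ℕ.* p
    g : ℕ → Carrier
    g j = x - pow R ω (j ℕ.* 1)
    A B : ℕ → Carrier
    A i = select (does (p ∣? suc i)) (select (isCoprime (suc i) m) (g (suc i)))
    B i = select (not (isCoprime (suc i) m)) (g (suc i))
    split : ∀ j → select (not (isCoprime j n)) (g j) ≈
                  select (does (p ∣? j)) (select (isCoprime j m) (g j)) * select (not (isCoprime j m)) (g j)
    split j = trans (reflexive (≡.cong (λ b → select (not b) (g j)) (isCoprime-*prime pp j m)))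
                    (select-split (isCoprime j m) (does (p ∣? j)) (g j))

  -- The factor Φ_{n_j}(x^(n/n_{j+1})) of H, for ps = p_1 … p_k, n_j = p_1 ⋯ p_j and ζ of order n;
  -- the N-th cyclotomic polynomial is taken at the root ζ^(n/n_j).
  HFactor : List ℕ → Carrier → Carrier → ℕ → Carrier
  HFactor ps ζ x j = Phi R ζ (suffixProd ps j) (prefixProd ps j) (pow R x (suffixProd ps (suc j)))

  H : List ℕ → Carrier → Carrier → Carrier
  H ps ζ x = prodR R (map (HFactor ps ζ x) (applyUpTo suc (length ps ℕ.∸ 1)))

  HFactor-∷ʳ : ∀ ps p ζ x j → j < length ps → HFactor (ps ∷ʳ p) ζ x j ≈ HFactor ps (pow R ζ p) (pow R x p) j
  HFactor-∷ʳ ps p ζ x j j<n = begin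
    HFactor (ps ∷ʳ p) ζ x j
      ≡⟨ ≡.cong₂ (λ e N → Phi R ζ e N (pow R x (suffixProd (ps ∷ʳ p) (suc j))))
                 (suffixProd-∷ʳ ps p j (ℕ.<⇒≤ j<n)) (prefixProd-∷ʳ ps p j (ℕ.<⇒≤ j<n)) ⟩
    Phi R ζ (suffixProd ps j ℕ.* p) (prefixProd ps j) (pow R x (suffixProd (ps ∷ʳ p) (suc j)))
      ≈⟨ Phi-congʳ ζ _ (prefixProd ps j) x^p^s≈ ⟨
    Phi R ζ (suffixProd ps j ℕ.* p) (prefixProd ps j) (pow R (pow R x p) s)
      ≈⟨ Phi-rescale ζ p (suffixProd ps j) (prefixProd ps j) _ ⟨
    HFactor ps (pow R ζ p) (pow R x p) j ∎
    where
    s = suffixProd ps (suc j)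
    x^p^s≈ : pow R (pow R x p) s ≈ pow R x (suffixProd (ps ∷ʳ p) (suc j))
    x^p^s≈ = trans (pow-* x p s)
      (reflexive (≡.cong (pow R x) (≡.trans (ℕ.*-comm p s) (≡.sym (suffixProd-∷ʳ ps p (suc j) j<n)))))

  HFactor-last : ∀ ps p ζ x → HFactor (ps ∷ʳ p) ζ x (length ps) ≈ Phi R ζ p (product ps) x
  HFactor-last ps p ζ x = begin
    HFactor (ps ∷ʳ p) ζ x (length ps)
      ≡⟨ ≡.cong₂ (λ e N → Phi R ζ e N (pow R x (suffixProd (ps ∷ʳ p) (suc (length ps)))))
                 (≡.trans (suffixProd-∷ʳ ps p (length ps) ℕ.≤-refl)
                          (≡.trans (≡.cong (ℕ._* p) (suffixProd-all ps (length ps) ℕ.≤-refl))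
                                   (ℕ.*-identityˡ p)))
                 (≡.trans (prefixProd-∷ʳ ps p (length ps) ℕ.≤-refl) (prefixProd-all ps)) ⟩
    Phi R ζ p (product ps) (pow R x (suffixProd (ps ∷ʳ p) (suc (length ps))))
      ≈⟨ Phi-congʳ ζ p (product ps) pow≈x ⟩
    Phi R ζ p (product ps) x ∎
    where
    pow≈x : pow R x (suffixProd (ps ∷ʳ p) (suc (length ps))) ≈ x
    pow≈x = trans (reflexive (≡.cong (pow R x) (suffixProd-all (ps ∷ʳ p) _ (ℕ.≤-reflexive (length-∷ʳ ps p)))))
                  (*-identityʳ x)

  H-∷ʳ : ∀ ps p ζ x → 1 ≤ length ps →
    H (ps ∷ʳ p) ζ x ≈ H ps (pow R ζ p) (pow R x p) * Phi R ζ p (product ps) x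
  H-∷ʳ ps p ζ x 1≤n = begin
    H (ps ∷ʳ p) ζ x
      ≈⟨ prodR-applyUpTo F suc (length (ps ∷ʳ p) ℕ.∸ 1) ⟩
    Π (λ i → F (suc i)) (length (ps ∷ʳ p) ℕ.∸ 1)
      ≡⟨ ≡.cong (Π (λ i → F (suc i))) (≡.trans (≡.cong (ℕ._∸ 1) (length-∷ʳ ps p)) n≡1+k) ⟩
    Π (λ i → F (suc i)) k * F (suc k)
      ≈⟨ *-cong (Π-cong k (λ i i<k → HFactor-∷ʳ ps p ζ x (suc i) (≡.subst (suc i <_) (≡.sym n≡1+k) (s≤s i<k))))
                (trans (reflexive (≡.cong F (≡.sym n≡1+k))) (HFactor-last ps p ζ x)) ⟩
    Π (λ i → G (suc i)) k * Phi R ζ p (product ps) x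
      ≈⟨ *-congʳ (prodR-applyUpTo G suc k) ⟨
    H ps (pow R ζ p) (pow R x p) * Phi R ζ p (product ps) x ∎
    where
    k = length ps ℕ.∸ 1
    n≡1+k : length ps ≡ suc k
    n≡1+k = ≡.sym (ℕ.m+[n∸m]≡n 1≤n)
    F G : ℕ → Carrier
    F = HFactor (ps ∷ʳ p) ζ x
    G = HFactor ps (pow R ζ p) (pow R x p)

  Claim : List ℕ → Set (c ⊔ ℓ)
  Claim ps = ∀ ζ → Primitive ζ (product ps) → ∀ x →
    Psi R ζ 1 (product ps) x ≈ H ps ζ x * (pow R x (suffixProd ps 1) - 1#)

  -- k = 1: Ψ_p(x) = x - 1, the case m = 1 of Psi-*prime.
  Claim-[p] : ∀ p → Prime p → Claim [ p ]
  Claim-[p] p pp ζ prim x = begin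
    Psi R ζ 1 (p ℕ.* 1) x                         ≡⟨ ≡.cong (λ n → Psi R ζ 1 n x) (ℕ.*-comm p 1) ⟩
    Psi R ζ 1 (1 ℕ.* p) x                         ≈⟨ Psi-*prime 1 p pp (coprime-product []) z<s prim′ x ⟩
    (x - pow R ζ (1 ℕ.* p)) * 1# * 1#             ≈⟨ trans (*-identityʳ _) (*-identityʳ _) ⟩
    x - pow R ζ (1 ℕ.* p)                         ≈⟨ +-cong (*-identityʳ x) (-‿cong (sym (proj₁ prim′))) ⟨
    x * 1# - 1#                                   ≈⟨ *-identityˡ _ ⟨
    1# * (x * 1# - 1#)                            ∎
    where
    prim′ : Primitive ζ (1 ℕ.* p)
    prim′ = ≡.subst (Primitive ζ) (ℕ.*-comm p 1) prim

  Claim-∷ʳ : ∀ ps p → 1 ≤ length ps → 0 < product ps → Prime p → Coprime p (product ps) →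
    Claim ps → Claim (ps ∷ʳ p)
  Claim-∷ʳ ps p 1≤n 0<n′ pp p⊥n′ claim-ps ζ prim x = begin
    Psi R ζ 1 (product (ps ∷ʳ p)) x              ≡⟨ ≡.cong (λ n → Psi R ζ 1 n x) (product-∷ʳ ps p) ⟩
    Psi R ζ 1 (n′ ℕ.* p) x                       ≈⟨ Psi-*prime n′ p pp p⊥n′ 0<n′ prim′ x ⟩
    Φ * Psi R ζ p n′ (pow R x p)                 ≈⟨ *-congˡ (Psi-rescale ζ p n′ (pow R x p)) ⟩
    Φ * Psi R (pow R ζ p) 1 n′ (pow R x p)       ≈⟨ *-congˡ (claim-ps (pow R ζ p) prim-p (pow R x p)) ⟩
    Φ * (H ps (pow R ζ p) (pow R x p) * L)       ≈⟨ x∙yz≈yx∙z Φ _ L ⟩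
    (H ps (pow R ζ p) (pow R x p) * Φ) * L       ≈⟨ *-cong (H-∷ʳ ps p ζ x 1≤n) (+-congʳ (sym x^[n/p₁])) ⟨
    H (ps ∷ʳ p) ζ x * (pow R x (suffixProd (ps ∷ʳ p) 1) - 1#) ∎
    where
    n′ = product ps
    Φ = Phi R ζ p n′ x
    L = pow R (pow R x p) (suffixProd ps 1) - 1#
    prim′ : Primitive ζ (n′ ℕ.* p)
    prim′ = ≡.subst (Primitive ζ) (product-∷ʳ ps p) prim
    prim-p : Primitive (pow R ζ p) n′
    prim-p = primitive-pow n′ p (ℕ.>-nonZero⁻¹ p {{prime⇒nonZero pp}}) prim′
    x^[n/p₁] : pow R (pow R x p) (suffixProd ps 1) ≈ pow R x (suffixProd (ps ∷ʳ p) 1)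
    x^[n/p₁] = trans (pow-* x p (suffixProd ps 1)) (reflexive (≡.cong (pow R x)
      (≡.trans (ℕ.*-comm p (suffixProd ps 1)) (≡.sym (suffixProd-∷ʳ ps p 1 1≤n)))))

  distinct-primes-claim : ∀ k ps → length ps ≡ suc k → All Prime ps → AllPairs _≢_ ps → Claim ps
  distinct-primes-claim k ps len primes distinct with initLast ps
  distinct-primes-claim k       .[]                ()  _          _        | []
  distinct-primes-claim zero    .([] ∷ʳ p)         _   (pp ∷ [])  _        | [] ∷ʳ′ p = Claim-[p] p pp
  distinct-primes-claim zero    .((q ∷ qs) ∷ʳ p)   len _          _        | (q ∷ qs) ∷ʳ′ p =
    contradiction (≡.trans (≡.sym (length-∷ʳ qs p)) (ℕ.suc-injective len)) λ ()
  distinct-primes-claim (suc k) .([] ∷ʳ p)         ()  _          _        | [] ∷ʳ′ p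
  distinct-primes-claim (suc k) .(qs ∷ʳ p)         len primes     distinct | qs ∷ʳ′ p =
    Claim-∷ʳ qs p 1≤n (productOfPrimes≥1 primes′) pp p⊥n′
      (distinct-primes-claim k qs n≡1+k primes′ distinct′)
    where
    n≡1+k : length qs ≡ suc k
    n≡1+k = ℕ.suc-injective (≡.trans (≡.sym (length-∷ʳ qs p)) len)
    1≤n : 1 ≤ length qs
    1≤n = ≡.subst (1 ≤_) (≡.sym n≡1+k) (s≤s z≤n)
    primes′ = proj₁ (∷ʳ⁻ primes)
    pp = proj₂ (∷ʳ⁻ primes)
    distinct′ = proj₁ (allPairs-∷ʳ⁻ distinct)
    p⊥n′ : Coprime p (product qs)
    p⊥n′ = coprime-product (All.zipWith p⊥ (proj₂ (allPairs-∷ʳ⁻ distinct) , primes′))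
      where
      p⊥ : ∀ {q} → q ≢ p × Prime q → Coprime p q
      p⊥ (q≢p , pq) = distinct-primes-coprime pp pq (≢-sym q≢p)

-- For p₁ < ⋯ < p_k the primes are pairwise distinct.
mainTheorem13 : ∀ {c ℓ} (R : CommutativeRing c ℓ) → IsIntegralDomain R →
    (ps : List ℕ) → 1 ≤ length ps → All (λ p → Prime p × p ≢ 2) ps → Linked _<_ ps →
    (ζ : CommutativeRing.Carrier R) → IsPrimitiveRoot R ζ (product ps) →
    (x : CommutativeRing.Carrier R) →
    CommutativeRing._≈_ R
      (Psi R ζ 1 (product ps) x)
      (CommutativeRing._*_ R
        (prodR R (map (λ j → Phi R ζ (suffixProd ps j) (prefixProd ps j) (pow R x (suffixProd ps (suc j))))
                      (applyUpTo suc (length ps ∸ 1))))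
        (CommutativeRing._-_ R (pow R x (suffixProd ps 1)) (CommutativeRing.1# R)))
mainTheorem13 R isID ps 1≤k primes increasing =
  Cyclotomic.distinct-primes-claim R isID (length ps ∸ 1) ps (≡.sym (ℕ.m+[n∸m]≡n 1≤k)) (All.map proj₁ primes)
    (AllPairs.map ℕ.<⇒≢ (Linked⇒AllPairs ℕ.<-trans increasing))
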